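{- Let $(G,G_\bullet)$ be a filtered group and $n\ge0$. A map $c:\{0,1\}^n\to G$ is in $C^n(G_\bullet)$ if and only if there is a polynomial map $g:\mathbb{Z}^n\to G$, adapted to the filtration $H_0=H_1=\mathbb{Z}^n$, $H_i=\{0\}$ ($i\ge2$) on $\mathbb{Z}^n$ and to $G_\bullet$, whose restriction to $\{0,1\}^n\subseteq\mathbb{Z}^n$ equals $c$.
   Context: Filtration: $G\ge G_0\ge G_1\ge\cdots$, $[G_i,G_j]\subseteq G_{i+j}$, standing convention $G_0=G_1=G$. Faces of $\{0,1\}^n$ are sets obtained by fixing some coordinates; codimension = number of fixed coordinates; $g^F$ is $g$ on $F$ and $\mathrm{id}_G$ elsewhere; $C^n(G_\bullet)$ is the subgroup of $G^{\{0,1\}^n}$ generated by the $g^F$ with $g\in G_{\mathrm{codim}(F)}$. For a filtered group $(H,H_\bullet)$, $g:H\to G$ is polynomial if $\partial_{h_1}\cdots\partial_{h_m}g(x)\in G_{i_1+\cdots+i_m}$ for all $m\ge0$, $i_j\ge0$, $h_j\in H_{i_j}$, $x\in H$, where $\partial_hg(x)=g(x)^{ -1}g(xh)$ (written additively in $H=\mathbb{Z}^n$: $g(x)^{ -1}g(x+h)$). -}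

module Defs where

open import Level using (Level; _⊔_; suc)
open import Algebra.Bundles using (Group)
open import Data.Nat using (ℕ; zero; _+_) renaming (suc to sucℕ)
open import Data.Integer using (ℤ; 0ℤ; 1ℤ) renaming (_+_ to _+ℤ_)
open import Data.Bool using (Bool; true; false; if_then_else_)
open import Data.Maybe using (Maybe; just; nothing)
open import Data.Vec using (Vec; []; _∷_; zipWith; replicate; map)
open import Data.List using (List; []; _∷_)
open import Data.List.Relation.Unary.All using (All)
open import Data.Product using (_×_; _,_; proj₁; proj₂)
open import Data.Unit.Polymorphic using (⊤)
open import Relation.Binary.PropositionalEquality using (_≡_)

record FilteredGroup (c ℓ p : Level) : Set (suc (c ⊔ ℓ ⊔ p)) where
  field
    group : Group c ℓ
  open Group group public
  field
    Fil        : ℕ → Carrier → Set p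
    Fil-resp   : ∀ i {x y} → x ≈ y → Fil i x → Fil i y
    Fil-ε      : ∀ i → Fil i ε
    Fil-∙      : ∀ i {x y} → Fil i x → Fil i y → Fil i (x ∙ y)
    Fil-⁻¹     : ∀ i {x} → Fil i x → Fil i (x ⁻¹)
    Fil-dec    : ∀ i {x} → Fil (sucℕ i) x → Fil i x
    Fil-0      : ∀ x → Fil 0 x
    Fil-1      : ∀ x → Fil 1 x
    Fil-comm   : ∀ i j {x y} → Fil i x → Fil j y →
                 Fil (i + j) (((x ⁻¹) ∙ (y ⁻¹)) ∙ (x ∙ y))

-- Points of {0,1}^n and faces of {0,1}^n.  A face is a vector of
-- coordinate constraints: nothing = free coordinate, just b = fixed to b.
Cube : ℕ → Set
Cube n = Vec Bool n

Face : ℕ → Set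
Face n = Vec (Maybe Bool) n

codim : ∀ {n} → Face n → ℕ
codim []            = 0
codim (nothing ∷ F) = codim F
codim (just _ ∷ F)  = sucℕ (codim F)

bitEq : Bool → Bool → Bool
bitEq true  true  = true
bitEq false false = true
bitEq _     _     = false

_∈Face_ : ∀ {n} → Cube n → Face n → Bool
[]      ∈Face []            = true
(_ ∷ x) ∈Face (nothing ∷ F) = x ∈Face F
(b ∷ x) ∈Face (just a ∷ F)  = if bitEq a b then x ∈Face F else false

module _ {c ℓ p} (FG : FilteredGroup c ℓ p) where
  open FilteredGroup FG

  faceElt : ∀ {n} → Carrier → Face n → Cube n → Carrier
  faceElt g F x = if x ∈Face F then g else ε

  -- C^n(G_•): the subgroup of G^{{0,1}^n} generated by the g^F with
  -- g ∈ G_{codim F} (equality in G^{{0,1}^n} is pointwise ≈).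
  data InC (n : ℕ) : (Cube n → Carrier) → Set (c ⊔ ℓ ⊔ p) where
    gen  : ∀ (F : Face n) {g} → Fil (codim F) g → InC n (faceElt g F)
    one  : InC n (λ _ → ε)
    mul  : ∀ {a b} → InC n a → InC n b → InC n (λ x → a x ∙ b x)
    inv  : ∀ {a} → InC n a → InC n (λ x → a x ⁻¹)
    resp : ∀ {a b} → (∀ x → a x ≈ b x) → InC n a → InC n b

  Zn : ℕ → Set
  Zn n = Vec ℤ n

  _+ᶻ_ : ∀ {n} → Zn n → Zn n → Zn n
  _+ᶻ_ = zipWith _+ℤ_

  InH : ∀ {n} → ℕ → Zn n → Set
  InH 0                   _ = ⊤
  InH 1                   _ = ⊤
  InH (sucℕ (sucℕ _)) h = h ≡ replicate _ 0ℤ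

  ∂ : ∀ {n} → Zn n → (Zn n → Carrier) → Zn n → Carrier
  ∂ h g x = (g x ⁻¹) ∙ g (x +ᶻ h)

  ∂s : ∀ {n} → List (ℕ × Zn n) → (Zn n → Carrier) → Zn n → Carrier
  ∂s []             g = g
  ∂s ((_ , h) ∷ hs) g = ∂ h (∂s hs g)

  degSum : ∀ {n} → List (ℕ × Zn n) → ℕ
  degSum []             = 0
  degSum ((i , _) ∷ hs) = i + degSum hs

  IsPolynomial : ∀ {n} → (Zn n → Carrier) → Set p
  IsPolynomial g = ∀ (hs : List (ℕ × Zn _)) →
    All (λ ih → InH (proj₁ ih) (proj₂ ih)) hs →
    ∀ x → Fil (degSum hs) (∂s hs g x)

  embed : ∀ {n} → Cube n → Zn n
  embed = map (λ b → if b then 1ℤ else 0ℤ)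

module Submission where

-- Polynomiality with respect to H₀ = H₁ = ℤⁿ, H_{≥2} = 0 says that every m-fold
-- derivative ∂_{h₁}⋯∂_{h_m} g takes values in G_m.  We work with the graded,
-- order-truncated version  Poly k m g  ("values in G_k, and every derivative is
-- Poly (k+1) (m-1)"), which supports induction on the order m.
--
-- (1) A normaliser for words in a free group decides the group identities behind
--     the Leibniz rules for ∂ of products, inverses and commutators.
-- (2) By the Lazard–Leibman argument these rules show that polynomial maps are closed
--     under products, inverses and commutators (with levels adding up).
-- (3) Poly k m for all m is equivalent to the derivative bounds of IsPolynomial.
-- (4) If Q : ℤⁿ → ℤ has vanishing (d+1)-fold differences and g ∈ G_{j+d}, then
--     x ↦ g^{Q(x)} is polynomial of level j.  Every face F has an integer polynomial
--     of degree codim F that is the indicator of F on {0,1}ⁿ, so every generator g^F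
--     of Cⁿ(G_•), hence by (2) every element, extends to a polynomial map.
-- (5) Conversely g(b, y) = g(0, y) · (∂_{e₁}g(0, y))^b on the cube, and ∂_{e₁}g is
--     polynomial for the shifted filtration G_{•+1}; induction on n, carried out in
--     the cube groups of shifted filtrations, shows that g restricted to {0,1}ⁿ is a cube.

open import Defs
open import Level using (Level; _⊔_)
open import Algebra.Bundles using (Group)
open import Data.Bool using (Bool; true; false; not; if_then_else_)
open import Data.Bool.Properties using () renaming (_≟_ to _≟ᴮ_)
open import Data.Fin using (Fin; zero; suc) renaming (_≟_ to _≟ᶠ_)
open import Data.Integer as ℤ using (ℤ; 0ℤ; 1ℤ; -1ℤ; +_; -[1+_])
import Data.Integer.Properties as ℤ
open import Data.Integer.Tactic.RingSolver using (solve-∀)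
open import Data.List using (List; []; _∷_; _++_)
open import Data.List.Relation.Unary.All using (All; []; _∷_)
open import Data.List.Relation.Unary.All.Properties using (++⁺)
open import Data.Maybe using (just; nothing)
open import Data.Nat using (ℕ; zero; suc; _+_; _≤_; _≤′_; ≤′-refl; ≤′-step; s≤s)
open import Data.Nat.Properties
  using (≤⇒≤′; +-suc; +-assoc; +-identityʳ; m≤m+n; n≤1+n; ≤-trans; ≤-reflexive; +-monoʳ-≤)
open import Data.Product using (Σ; _×_; _,_; proj₁; proj₂)
open import Data.Product.Properties using (≡-dec)
open import Data.Unit.Polymorphic using (tt)
open import Data.Vec using (Vec; []; _∷_; lookup; head; tail; replicate; zipWith)
open import Data.Vec.Properties using (zipWith-identityʳ)
open import Function.Bundles using (_⇔_; mk⇔)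
open import Relation.Nullary using (yes; no)
open import Relation.Binary.PropositionalEquality as ≡ using (_≡_)
import Relation.Binary.Reasoning.Setoid as SetoidReasoning

-- Group identities by free reduction

module GroupWords {c ℓ} (G : Group c ℓ) where
  open Group G
  open import Algebra.Properties.Group G using (⁻¹-involutive; ε⁻¹≈ε; ⁻¹-anti-homo-∙)
  open SetoidReasoning setoid

  infixl 7 _∙ᴱ_
  infix  8 _⁻¹ᴱ

  data Expr (n : ℕ) : Set where
    varᴱ  : Fin n → Expr n
    _∙ᴱ_  : Expr n → Expr n → Expr n
    _⁻¹ᴱ  : Expr n → Expr n

  ⟦_⟧ : ∀ {n} → Expr n → Vec Carrier n → Carrier
  ⟦ varᴱ i ⟧ ρ = lookup ρ i
  ⟦ a ∙ᴱ b ⟧ ρ = ⟦ a ⟧ ρ ∙ ⟦ b ⟧ ρ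
  ⟦ a ⁻¹ᴱ ⟧  ρ = ⟦ a ⟧ ρ ⁻¹

  -- A letter (b , i) is the variable xᵢ (b = false) or its inverse (b = true).
  Letter : ℕ → Set
  Letter n = Bool × Fin n

  Word : ℕ → Set
  Word n = List (Letter n)

  inverseLetter : ∀ {n} → Letter n → Letter n
  inverseLetter (b , i) = not b , i

  -- Prepend a letter, cancelling it against its inverse at the front of the word.
  -- Applied to reduced words this keeps them reduced, so normal forms are reduced words.
  cons : ∀ {n} → Letter n → Word n → Word n
  cons l []       = l ∷ []
  cons l (l′ ∷ w) with ≡-dec _≟ᴮ_ _≟ᶠ_ (inverseLetter l) l′
  ... | yes _ = w
  ... | no  _ = l ∷ l′ ∷ w

  _·ʷ_ : ∀ {n} → Word n → Word n → Word n
  []      ·ʷ w = w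
  (l ∷ u) ·ʷ w = cons l (u ·ʷ w)

  inverseWord : ∀ {n} → Word n → Word n
  inverseWord []      = []
  inverseWord (l ∷ u) = inverseWord u ·ʷ (inverseLetter l ∷ [])

  normalForm : ∀ {n} → Expr n → Word n
  normalForm (varᴱ i) = (false , i) ∷ []
  normalForm (a ∙ᴱ b) = normalForm a ·ʷ normalForm b
  normalForm (a ⁻¹ᴱ)  = inverseWord (normalForm a)

  module Soundness {n} (ρ : Vec Carrier n) where
    letter : Letter n → Carrier
    letter (false , i) = lookup ρ i
    letter (true  , i) = lookup ρ i ⁻¹

    word : Word n → Carrier
    word []      = ε
    word (l ∷ w) = letter l ∙ word w

    letter-inverse : ∀ l → letter (inverseLetter l) ≈ letter l ⁻¹
    letter-inverse (false , i) = refl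
    letter-inverse (true  , i) = sym (⁻¹-involutive _)

    cons-sound : ∀ l w → word (cons l w) ≈ letter l ∙ word w
    cons-sound l []       = refl
    cons-sound l (l′ ∷ w) with ≡-dec _≟ᴮ_ _≟ᶠ_ (inverseLetter l) l′
    ... | yes ≡.refl = begin
      word w                                          ≈⟨ identityˡ _ ⟨
      ε ∙ word w                                      ≈⟨ ∙-congʳ (inverseʳ _) ⟨
      (letter l ∙ letter l ⁻¹) ∙ word w               ≈⟨ ∙-congʳ (∙-congˡ (letter-inverse l)) ⟨
      (letter l ∙ letter (inverseLetter l)) ∙ word w  ≈⟨ assoc _ _ _ ⟩
      letter l ∙ (letter (inverseLetter l) ∙ word w)  ∎
    ... | no _ = refl

    ·ʷ-sound : ∀ u w → word (u ·ʷ w) ≈ word u ∙ word w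
    ·ʷ-sound []      w = sym (identityˡ _)
    ·ʷ-sound (l ∷ u) w = begin
      word (cons l (u ·ʷ w))         ≈⟨ cons-sound l (u ·ʷ w) ⟩
      letter l ∙ word (u ·ʷ w)       ≈⟨ ∙-congˡ (·ʷ-sound u w) ⟩
      letter l ∙ (word u ∙ word w)   ≈⟨ assoc _ _ _ ⟨
      (letter l ∙ word u) ∙ word w   ∎

    inverseWord-sound : ∀ u → word (inverseWord u) ≈ word u ⁻¹
    inverseWord-sound []      = sym ε⁻¹≈ε
    inverseWord-sound (l ∷ u) = begin
      word (inverseWord u ·ʷ (inverseLetter l ∷ []))   ≈⟨ ·ʷ-sound (inverseWord u) _ ⟩
      word (inverseWord u) ∙ (letter (inverseLetter l) ∙ ε)
                                                       ≈⟨ ∙-cong (inverseWord-sound u) (identityʳ _) ⟩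
      word u ⁻¹ ∙ letter (inverseLetter l)             ≈⟨ ∙-congˡ (letter-inverse l) ⟩
      word u ⁻¹ ∙ letter l ⁻¹                          ≈⟨ ⁻¹-anti-homo-∙ _ _ ⟨
      (letter l ∙ word u) ⁻¹                           ∎

    normalForm-sound : ∀ e → word (normalForm e) ≈ ⟦ e ⟧ ρ
    normalForm-sound (varᴱ i) = identityʳ _
    normalForm-sound (a ∙ᴱ b) =
      trans (·ʷ-sound (normalForm a) (normalForm b)) (∙-cong (normalForm-sound a) (normalForm-sound b))
    normalForm-sound (a ⁻¹ᴱ)  =
      trans (inverseWord-sound (normalForm a)) (⁻¹-cong (normalForm-sound a))

  solve : ∀ {n} (a b : Expr n) → normalForm a ≡ normalForm b → ∀ ρ → ⟦ a ⟧ ρ ≈ ⟦ b ⟧ ρ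
  solve a b same ρ = begin
    ⟦ a ⟧ ρ                ≈⟨ normalForm-sound a ⟨
    word (normalForm a)    ≡⟨ ≡.cong word same ⟩
    word (normalForm b)    ≈⟨ normalForm-sound b ⟩
    ⟦ b ⟧ ρ                ∎
    where open Soundness ρ

-- Integer-valued functions on ℤⁿ with vanishing finite differences

infixl 6 _⊞_

_⊞_ : ∀ {n} → Vec ℤ n → Vec ℤ n → Vec ℤ n
_⊞_ = zipWith ℤ._+_

Δ : ∀ {n} → Vec ℤ n → (Vec ℤ n → ℤ) → Vec ℤ n → ℤ
Δ h Q x = Q (x ⊞ h) ℤ.- Q x

-- All d-fold differences of Q vanish, i.e. Q is a polynomial of degree < d.
Vanishes : ∀ {n} → ℕ → (Vec ℤ n → ℤ) → Set
Vanishes zero    Q = ∀ x → Q x ≡ 0ℤ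
Vanishes (suc d) Q = ∀ h → Vanishes d (Δ h Q)

vanishes-resp : ∀ {n} d {Q R : Vec ℤ n → ℤ} → (∀ x → Q x ≡ R x) → Vanishes d Q → Vanishes d R
vanishes-resp zero    Q≡R v x = ≡.trans (≡.sym (Q≡R x)) (v x)
vanishes-resp (suc d) Q≡R v h = vanishes-resp d (λ x → ≡.cong₂ ℤ._-_ (Q≡R _) (Q≡R x)) (v h)

vanishes-zero : ∀ {n} d → Vanishes {n} d (λ _ → 0ℤ)
vanishes-zero zero    x = ≡.refl
vanishes-zero (suc d) h = vanishes-zero d

vanishes-+ : ∀ {n} d {Q R : Vec ℤ n → ℤ} → Vanishes d Q → Vanishes d R →
             Vanishes d (λ x → Q x ℤ.+ R x)
vanishes-+ zero    vQ vR x = ≡.cong₂ ℤ._+_ (vQ x) (vR x)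
vanishes-+ (suc d) {Q} {R} vQ vR h =
  vanishes-resp d (λ x → difference-+ (Q (x ⊞ h)) (Q x) (R (x ⊞ h)) (R x)) (vanishes-+ d (vQ h) (vR h))
  where
  difference-+ : ∀ a b c e → (a ℤ.- b) ℤ.+ (c ℤ.- e) ≡ (a ℤ.+ c) ℤ.- (b ℤ.+ e)
  difference-+ = solve-∀

vanishes-scale : ∀ {n} d s {Q : Vec ℤ n → ℤ} → Vanishes d Q → Vanishes d (λ x → s ℤ.* Q x)
vanishes-scale zero    s v x = ≡.trans (≡.cong (s ℤ.*_) (v x)) (ℤ.*-zeroʳ s)
vanishes-scale (suc d) s {Q} v h =
  vanishes-resp d (λ x → difference-scale s (Q (x ⊞ h)) (Q x)) (vanishes-scale d s (v h))
  where
  difference-scale : ∀ s a b → s ℤ.* (a ℤ.- b) ≡ s ℤ.* a ℤ.- s ℤ.* b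
  difference-scale = solve-∀

vanishes-tail : ∀ {n} d {Q : Vec ℤ n → ℤ} → Vanishes d Q → Vanishes d (λ x → Q (tail x))
vanishes-tail zero    v x = v (tail x)
vanishes-tail (suc d) v (a ∷ h) =
  vanishes-resp d (λ { (z ∷ y) → ≡.refl }) (vanishes-tail d (v h))

affine : ∀ {n} → ℤ → ℤ → (Vec ℤ n → ℤ) → Vec ℤ (suc n) → ℤ
affine α β Q x = (α ℤ.* head x ℤ.+ β) ℤ.* Q (tail x)

-- Δ_{(a,h)} of the product: a product of the same shape plus a lower-degree term.
affine-difference : ∀ α β z a q q′ →
  (α ℤ.* (z ℤ.+ a) ℤ.+ β) ℤ.* q′ ℤ.- (α ℤ.* z ℤ.+ β) ℤ.* q
    ≡ (α ℤ.* z ℤ.+ (α ℤ.* a ℤ.+ β)) ℤ.* (q′ ℤ.- q) ℤ.+ (α ℤ.* a) ℤ.* q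
affine-difference = solve-∀

vanishes-affine : ∀ {n} d α β {Q : Vec ℤ n → ℤ} → Vanishes d Q → Vanishes (suc d) (affine α β Q)
vanishes-affine zero α β {Q} v =
  vanishes-resp 1 {λ _ → 0ℤ} {affine α β Q} (λ x → ≡.sym (vanishing-factor x)) (vanishes-zero 1)
  where
  vanishing-factor : ∀ x → affine α β Q x ≡ 0ℤ
  vanishing-factor (z ∷ y) = ≡.trans (≡.cong ((α ℤ.* z ℤ.+ β) ℤ.*_) (v y)) (ℤ.*-zeroʳ (α ℤ.* z ℤ.+ β))
vanishes-affine (suc d) α β {Q} v (a ∷ h) =
  vanishes-resp (suc d) split
    (vanishes-+ (suc d) {affine α (α ℤ.* a ℤ.+ β) (Δ h Q)} {λ x → (α ℤ.* a) ℤ.* Q (tail x)}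
      (vanishes-affine d α (α ℤ.* a ℤ.+ β) (v h))
      (vanishes-scale (suc d) (α ℤ.* a) (vanishes-tail (suc d) {Q} v)))
  where
  split : ∀ x → affine α (α ℤ.* a ℤ.+ β) (Δ h Q) x ℤ.+ (α ℤ.* a) ℤ.* Q (tail x)
                  ≡ Δ (a ∷ h) (affine α β Q) x
  split (z ∷ y) = ≡.sym (affine-difference α β z a (Q y) (Q (y ⊞ h)))

-- The coordinate factor z on {z = 1} and 1 - z on {z = 0}.
slope offset : Bool → ℤ
slope true   = 1ℤ
slope false  = -1ℤ
offset true  = 0ℤ
offset false = 1ℤ

-- An integer polynomial of degree codim F which is the indicator of F on {0,1}ⁿ.
facePoly : ∀ {n} → Face n → Vec ℤ n → ℤ
facePoly []            = λ _ → 1ℤ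
facePoly (nothing ∷ F) = λ x → facePoly F (tail x)
facePoly (just b ∷ F)  = affine (slope b) (offset b) (facePoly F)

vanishes-facePoly : ∀ {n} (F : Face n) → Vanishes (suc (codim F)) (facePoly F)
vanishes-facePoly []            = λ _ _ → ≡.refl
vanishes-facePoly (nothing ∷ F) = vanishes-tail (suc (codim F)) {facePoly F} (vanishes-facePoly F)
vanishes-facePoly (just b ∷ F)  = vanishes-affine (suc (codim F)) (slope b) (offset b) {facePoly F}
                                    (vanishes-facePoly F)

-- Polynomial maps into a filtered group

module FilteredPolynomials {c ℓ p} (FG : FilteredGroup c ℓ p) where
  open FilteredGroup FG
  open GroupWords group using (Expr; varᴱ; _∙ᴱ_; _⁻¹ᴱ; solve)
  open import Algebra.Properties.Group group using (ε⁻¹≈ε; ⁻¹-anti-homo-∙)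
  open SetoidReasoning setoid

  Fil-mono : ∀ {k k′ x} → k ≤ k′ → Fil k′ x → Fil k x
  Fil-mono k≤k′ = go (≤⇒≤′ k≤k′)
    where
    go : ∀ {k k′ x} → k ≤′ k′ → Fil k′ x → Fil k x
    go ≤′-refl      x∈ = x∈
    go (≤′-step k≤) x∈ = go k≤ (Fil-dec _ x∈)

  [_,_] : Carrier → Carrier → Carrier
  [ x , y ] = (x ⁻¹ ∙ y ⁻¹) ∙ (x ∙ y)

  -- With f′ = f(x+h), g′ = g(x+h) the increments are
  -- a = f⁻¹f′ = ∂_h f(x) and b = g⁻¹g′ = ∂_h g(x); each right-hand side is ∂_h of a
  -- product, an inverse or a commutator written in terms of a, b, f, g.
  private
    module Letters where
      F G F′ G′ A B : Expr 4
      F  = varᴱ zero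
      F′ = varᴱ (suc zero)
      G  = varᴱ (suc (suc zero))
      G′ = varᴱ (suc (suc (suc zero)))
      A  = F ⁻¹ᴱ ∙ᴱ F′
      B  = G ⁻¹ᴱ ∙ᴱ G′

      [_,_]ᴱ : Expr 4 → Expr 4 → Expr 4
      [ x , y ]ᴱ = (x ⁻¹ᴱ ∙ᴱ y ⁻¹ᴱ) ∙ᴱ (x ∙ᴱ y)

  ∂-product : ∀ f f′ g g′ → let a = f ⁻¹ ∙ f′ ; b = g ⁻¹ ∙ g′ in
    a ∙ ([ a , g ] ∙ b) ≈ (f ∙ g) ⁻¹ ∙ (f′ ∙ g′)
  ∂-product f f′ g g′ = solve (A ∙ᴱ ([ A , G ]ᴱ ∙ᴱ B)) ((F ∙ᴱ G) ⁻¹ᴱ ∙ᴱ (F′ ∙ᴱ G′)) ≡.refl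
    (f ∷ f′ ∷ g ∷ g′ ∷ [])
    where open Letters

  ∂-inverse : ∀ f f′ → let a = f ⁻¹ ∙ f′ in
    a ⁻¹ ∙ [ a ⁻¹ , f ⁻¹ ] ≈ (f ⁻¹) ⁻¹ ∙ f′ ⁻¹
  ∂-inverse f f′ = solve (A ⁻¹ᴱ ∙ᴱ [ A ⁻¹ᴱ , F ⁻¹ᴱ ]ᴱ) ((F ⁻¹ᴱ) ⁻¹ᴱ ∙ᴱ F′ ⁻¹ᴱ) ≡.refl
    (f ∷ f′ ∷ ε ∷ ε ∷ [])  -- the letters G, G′ do not occur
    where open Letters

  ∂-commutator : ∀ f f′ g g′ →
    let a = f ⁻¹ ∙ f′ ; b = g ⁻¹ ∙ g′ ; c = [ f , g ] ; X = [ f , b ] ∙ (c ∙ [ c , b ]) in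
    [ f , b ] ∙ ([ [ f , b ] , c ] ∙ ([ c , b ] ∙ ([ X , a ] ∙ ([ a , b ] ∙ ([ a , g ] ∙ [ [ a , g ] , b ])))))
      ≈ [ f , g ] ⁻¹ ∙ [ f′ , g′ ]
  ∂-commutator f f′ g g′ = solve
    ([ F , B ]ᴱ ∙ᴱ ([ [ F , B ]ᴱ , C ]ᴱ ∙ᴱ ([ C , B ]ᴱ ∙ᴱ ([ X , A ]ᴱ ∙ᴱ ([ A , B ]ᴱ ∙ᴱ
       ([ A , G ]ᴱ ∙ᴱ [ [ A , G ]ᴱ , B ]ᴱ))))))
    ([ F , G ]ᴱ ⁻¹ᴱ ∙ᴱ [ F′ , G′ ]ᴱ) ≡.refl (f ∷ f′ ∷ g ∷ g′ ∷ [])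
    where
    open Letters
    C X : Expr 4
    C = [ F , G ]ᴱ
    X = [ F , B ]ᴱ ∙ᴱ (C ∙ᴱ [ C , B ]ᴱ)

  Poly : ∀ {n} → ℕ → ℕ → (Vec ℤ n → Carrier) → Set p
  Poly k zero    f = ∀ x → Fil k (f x)
  Poly k (suc m) f = (∀ x → Fil k (f x)) × (∀ h → Poly (suc k) m (∂ FG h f))

  module _ {n : ℕ} where
    lower-order : ∀ {k} m {f : Vec ℤ n → Carrier} → Poly k (suc m) f → Poly k m f
    lower-order zero    pf = proj₁ pf
    lower-order (suc m) pf = proj₁ pf , λ h → lower-order m (proj₂ pf h)

    ∂-resp : ∀ {f g : Vec ℤ n → Carrier} h → (∀ x → f x ≈ g x) → ∀ x → ∂ FG h f x ≈ ∂ FG h g x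
    ∂-resp h f≈g x = ∙-cong (⁻¹-cong (f≈g x)) (f≈g _)

    poly-resp : ∀ {k} m {f g : Vec ℤ n → Carrier} → (∀ x → f x ≈ g x) → Poly k m f → Poly k m g
    poly-resp zero    f≈g pf x = Fil-resp _ (f≈g x) (pf x)
    poly-resp (suc m) f≈g pf =
      (λ x → Fil-resp _ (f≈g x) (proj₁ pf x)) , λ h → poly-resp m (∂-resp h f≈g) (proj₂ pf h)

    poly-mono : ∀ {k k′} m {f : Vec ℤ n → Carrier} → k ≤ k′ → Poly k′ m f → Poly k m f
    poly-mono zero    k≤k′ pf x = Fil-mono k≤k′ (pf x)
    poly-mono (suc m) k≤k′ pf = (λ x → Fil-mono k≤k′ (proj₁ pf x)) , λ h → poly-mono m (s≤s k≤k′) (proj₂ pf h)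

    poly-ε : ∀ {k} m → Poly k m (λ (_ : Vec ℤ n) → ε)
    poly-ε zero    x = Fil-ε _
    poly-ε (suc m) = (λ x → Fil-ε _) , λ h → poly-resp m (λ x → sym (inverseˡ ε)) (poly-ε m)

    -- Lazard–Leibman: products, inverses and commutators of polynomial maps are
    -- polynomial, by simultaneous induction on the order using the Leibniz rules.
    mutual
      poly-∙ : ∀ {k} m {f g : Vec ℤ n → Carrier} → Poly k m f → Poly k m g → Poly k m (λ x → f x ∙ g x)
      poly-∙ zero pf pg x = Fil-∙ _ (pf x) (pg x)
      poly-∙ {k} (suc m) {f} {g} pf pg = (λ x → Fil-∙ _ (proj₁ pf x) (proj₁ pg x)) , λ h →
        let ∂f = proj₂ pf h ; ∂g = proj₂ pg h
            [∂f,g] = poly-[,] m ∂f (lower-order m pg)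
        in poly-resp m (λ x → ∂-product (f x) (f (x ⊞ h)) (g x) (g (x ⊞ h)))
             (poly-∙ m ∂f (poly-∙ m (poly-mono m (m≤m+n (suc k) k) [∂f,g]) ∂g))

      poly-⁻¹ : ∀ {k} m {f : Vec ℤ n → Carrier} → Poly k m f → Poly k m (λ x → f x ⁻¹)
      poly-⁻¹ zero pf x = Fil-⁻¹ _ (pf x)
      poly-⁻¹ {k} (suc m) {f} pf = (λ x → Fil-⁻¹ _ (proj₁ pf x)) , λ h →
        let ∂f⁻¹ = poly-⁻¹ m (proj₂ pf h)
            [∂f⁻¹,f⁻¹] = poly-[,] m ∂f⁻¹ (poly-⁻¹ m (lower-order m pf))
        in poly-resp m (λ x → ∂-inverse (f x) (f (x ⊞ h)))
             (poly-∙ m ∂f⁻¹ (poly-mono m (m≤m+n (suc k) k) [∂f⁻¹,f⁻¹]))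

      poly-[,] : ∀ {k l} m {f g : Vec ℤ n → Carrier} → Poly k m f → Poly l m g →
                 Poly (k + l) m (λ x → [ f x , g x ])
      poly-[,] {k} {l} zero pf pg x = Fil-comm k l (pf x) (pg x)
      poly-[,] {k} {l} (suc m) {f} {g} pf pg = (λ x → Fil-comm k l (proj₁ pf x) (proj₁ pg x)) , derivative
        where
        -- each level occurring below is at least k + l + 1
        ≤fb : suc (k + l) ≤ k + suc l
        ≤fb = ≤-reflexive (≡.sym (+-suc k l))
        ≤fbfg : suc (k + l) ≤ (k + suc l) + (k + l)
        ≤fbfg = ≤-trans ≤fb (m≤m+n _ _)
        ≤fgb : suc (k + l) ≤ (k + l) + suc l
        ≤fgb = ≤-trans (s≤s (m≤m+n (k + l) l)) (≤-reflexive (≡.sym (+-suc (k + l) l)))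
        ≤Xa : suc (k + l) ≤ (k + l) + suc k
        ≤Xa = ≤-trans (s≤s (m≤m+n (k + l) k)) (≤-reflexive (≡.sym (+-suc (k + l) k)))
        ≤ab : suc (k + l) ≤ suc k + suc l
        ≤ab = s≤s (+-monoʳ-≤ k (n≤1+n l))

        derivative : ∀ h → Poly (suc (k + l)) m (∂ FG h (λ x → [ f x , g x ]))
        derivative h =
          let a = proj₂ pf h ; b = proj₂ pg h
              fg = poly-[,] m (lower-order m pf) (lower-order m pg)
              fb = poly-[,] m (lower-order m pf) b
              fbfg = poly-[,] m fb fg
              fgb = poly-[,] m fg b
              X = poly-∙ m (poly-mono m (+-monoʳ-≤ k (n≤1+n l)) fb)
                    (poly-∙ m fg (poly-mono m (m≤m+n (k + l) (suc l)) fgb))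
              Xa = poly-[,] m X a
              ab = poly-[,] m a b
              ag = poly-[,] m a (lower-order m pg)
              agb = poly-[,] m ag b
          in poly-resp m (λ x → ∂-commutator (f x) (f (x ⊞ h)) (g x) (g (x ⊞ h)))
               (poly-∙ m (poly-mono m ≤fb fb) (poly-∙ m (poly-mono m ≤fbfg fbfg)
                 (poly-∙ m (poly-mono m ≤fgb fgb) (poly-∙ m (poly-mono m ≤Xa Xa)
                   (poly-∙ m (poly-mono m ≤ab ab) (poly-∙ m ag (poly-mono m (m≤m+n _ _) agb)))))))

    Poly∞ : ℕ → (Vec ℤ n → Carrier) → Set p
    Poly∞ k f = ∀ m → Poly k m f

    Admissible : List (ℕ × Vec ℤ n) → Set
    Admissible = All (λ ih → InH FG (proj₁ ih) (proj₂ ih))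

    ∂-zero : ∀ (f : Vec ℤ n → Carrier) x → ∂ FG (replicate n 0ℤ) f x ≈ ε
    ∂-zero f x = trans (∙-congˡ (reflexive (≡.cong f (zipWith-identityʳ ℤ.+-identityʳ x)))) (inverseˡ _)

    -- Derivatives along admissible directions raise the level by their degree;
    -- directions in H_{≥2} are 0, along which the derivative is trivial.
    poly-∂s : ∀ {k} (hs : List (ℕ × Vec ℤ n)) → Admissible hs →
              ∀ {f} → Poly∞ k f → Poly∞ (degSum FG hs + k) (∂s FG hs f)
    poly-∂s []                          []        pf   = pf
    poly-∂s ((zero , h) ∷ hs)           (_ ∷ adm) pf m = poly-mono m (n≤1+n _) (proj₂ (poly-∂s hs adm pf (suc m)) h)
    poly-∂s ((suc zero , h) ∷ hs)       (_ ∷ adm) pf m = proj₂ (poly-∂s hs adm pf (suc m)) h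
    poly-∂s ((suc (suc i) , h) ∷ hs) (≡.refl ∷ adm) {f} pf m =
      poly-resp m (λ x → sym (∂-zero (∂s FG hs f) x)) (poly-ε m)

    Poly∞⇒polynomial : ∀ {g} → Poly∞ 0 g → IsPolynomial FG g
    Poly∞⇒polynomial {g} pg hs adm x =
      ≡.subst (λ j → Fil j (∂s FG hs g x)) (+-identityʳ _) (poly-∂s hs adm pg 0 x)

    BoundedDerivatives : ℕ → (Vec ℤ n → Carrier) → Set p
    BoundedDerivatives k f = ∀ hs → Admissible hs → ∀ x → Fil (degSum FG hs + k) (∂s FG hs f x)

    ∂s-++ : ∀ (hs ks : List (ℕ × Vec ℤ n)) f x → ∂s FG (hs ++ ks) f x ≡ ∂s FG hs (∂s FG ks f) x
    ∂s-++ []             ks f x = ≡.refl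
    ∂s-++ ((_ , h) ∷ hs) ks f x = ≡.cong₂ (λ u v → u ⁻¹ ∙ v) (∂s-++ hs ks f x) (∂s-++ hs ks f (x ⊞ h))

    degSum-++ : ∀ (hs ks : List (ℕ × Vec ℤ n)) → degSum FG (hs ++ ks) ≡ degSum FG hs + degSum FG ks
    degSum-++ []             ks = ≡.refl
    degSum-++ ((i , _) ∷ hs) ks = ≡.trans (≡.cong (λ s → i + s) (degSum-++ hs ks)) (≡.sym (+-assoc i _ _))

    bounded-∂ : ∀ {k f} → BoundedDerivatives k f → ∀ h → BoundedDerivatives (suc k) (∂ FG h f)
    bounded-∂ {k} {f} bounds h hs adm x =
      ≡.subst₂ Fil degree (∂s-++ hs ((1 , h) ∷ []) f x) (bounds (hs ++ (1 , h) ∷ []) (++⁺ adm (tt ∷ [])) x)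
      where
      degree : degSum FG (hs ++ (1 , h) ∷ []) + k ≡ degSum FG hs + suc k
      degree = ≡.trans (≡.cong (_+ k) (degSum-++ hs ((1 , h) ∷ []))) (+-assoc (degSum FG hs) 1 k)

    bounded⇒poly : ∀ m {k f} → BoundedDerivatives k f → Poly k m f
    bounded⇒poly zero    bounds = bounds [] []
    bounded⇒poly (suc m) bounds = bounds [] [] , λ h → bounded⇒poly m (bounded-∂ bounds h)

    polynomial⇒Poly∞ : ∀ {g} → IsPolynomial FG g → Poly∞ 0 g
    polynomial⇒Poly∞ {g} pg m = bounded⇒poly m λ hs adm x →
      ≡.subst (λ j → Fil j (∂s FG hs g x)) (≡.sym (+-identityʳ _)) (pg hs adm x)

  open import Algebra.Properties.Monoid.Mult monoid using () renaming (_×_ to _×ᴳ_)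

  _^_ : Carrier → ℤ → Carrier
  g ^ (+ k)     = k ×ᴳ g
  g ^ -[1+ k ]  = (suc k ×ᴳ g) ⁻¹

  private
    module Cancel where
      X Y : Expr 2
      X = varᴱ zero
      Y = varᴱ (suc zero)

  cancelˡ : ∀ x y → x ∙ (x ⁻¹ ∙ y) ≈ y
  cancelˡ x y = solve (X ∙ᴱ (X ⁻¹ᴱ ∙ᴱ Y)) Y ≡.refl (x ∷ y ∷ []) where open Cancel

  cancelˡ⁻¹ : ∀ x y → x ⁻¹ ∙ (x ∙ y) ≈ y
  cancelˡ⁻¹ x y = solve (X ⁻¹ᴱ ∙ᴱ (X ∙ᴱ Y)) Y ≡.refl (x ∷ y ∷ []) where open Cancel

  -- g commutes with its powers, so (g · gᵏ)⁻¹ = g⁻¹ · (gᵏ)⁻¹.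
  ×ᴳ-comm : ∀ g k → k ×ᴳ g ∙ g ≈ g ∙ k ×ᴳ g
  ×ᴳ-comm g zero    = trans (identityˡ g) (sym (identityʳ g))
  ×ᴳ-comm g (suc k) = trans (assoc _ _ _) (∙-congˡ (×ᴳ-comm g k))

  ×ᴳ-suc-inverse : ∀ g k → (suc k ×ᴳ g) ⁻¹ ≈ g ⁻¹ ∙ (k ×ᴳ g) ⁻¹
  ×ᴳ-suc-inverse g k = trans (⁻¹-cong (sym (×ᴳ-comm g k))) (⁻¹-anti-homo-∙ _ _)

  ^-suc : ∀ g a → g ^ (1ℤ ℤ.+ a) ≈ g ∙ g ^ a
  ^-suc g (+ k)            = refl
  ^-suc g -[1+ zero ]      = sym (trans (∙-congˡ (⁻¹-cong (identityʳ g))) (inverseʳ g))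
  ^-suc g -[1+ suc k ]     = sym (trans (∙-congˡ (×ᴳ-suc-inverse g (suc k))) (cancelˡ _ _))

  ^-pred : ∀ g a → g ^ (-1ℤ ℤ.+ a) ≈ g ⁻¹ ∙ g ^ a
  ^-pred g -[1+ k ]     = ×ᴳ-suc-inverse g (suc k)
  ^-pred g (+ zero)     = trans (⁻¹-cong (identityʳ g)) (sym (identityʳ _))
  ^-pred g (+ suc k)    = sym (cancelˡ⁻¹ _ _)

  ^-+ : ∀ g a b → g ^ (a ℤ.+ b) ≈ g ^ a ∙ g ^ b
  ^-+ g (+ zero) b = begin
    g ^ (+ 0 ℤ.+ b)   ≡⟨ ≡.cong (g ^_) (ℤ.+-identityˡ b) ⟩
    g ^ b             ≈⟨ identityˡ _ ⟨
    ε ∙ g ^ b         ∎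
  ^-+ g (+ suc k) b = begin
    g ^ ((1ℤ ℤ.+ + k) ℤ.+ b)    ≡⟨ ≡.cong (g ^_) (ℤ.+-assoc 1ℤ (+ k) b) ⟩
    g ^ (1ℤ ℤ.+ (+ k ℤ.+ b))    ≈⟨ ^-suc g (+ k ℤ.+ b) ⟩
    g ∙ g ^ (+ k ℤ.+ b)         ≈⟨ ∙-congˡ (^-+ g (+ k) b) ⟩
    g ∙ (g ^ (+ k) ∙ g ^ b)     ≈⟨ assoc _ _ _ ⟨
    (g ∙ g ^ (+ k)) ∙ g ^ b     ∎
  ^-+ g -[1+ zero ] b = begin
    g ^ (-1ℤ ℤ.+ b)             ≈⟨ ^-pred g b ⟩
    g ⁻¹ ∙ g ^ b                ≈⟨ ∙-congʳ (⁻¹-cong (identityʳ g)) ⟨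
    (g ∙ ε) ⁻¹ ∙ g ^ b          ∎
  ^-+ g -[1+ suc k ] b = begin
    g ^ ((-1ℤ ℤ.+ -[1+ k ]) ℤ.+ b)    ≡⟨ ≡.cong (g ^_) (ℤ.+-assoc -1ℤ -[1+ k ] b) ⟩
    g ^ (-1ℤ ℤ.+ (-[1+ k ] ℤ.+ b))    ≈⟨ ^-pred g (-[1+ k ] ℤ.+ b) ⟩
    g ⁻¹ ∙ g ^ (-[1+ k ] ℤ.+ b)       ≈⟨ ∙-congˡ (^-+ g -[1+ k ] b) ⟩
    g ⁻¹ ∙ (g ^ -[1+ k ] ∙ g ^ b)     ≈⟨ assoc _ _ _ ⟨
    (g ⁻¹ ∙ g ^ -[1+ k ]) ∙ g ^ b     ≈⟨ ∙-congʳ (^-pred g -[1+ k ]) ⟨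
    g ^ -[1+ suc k ] ∙ g ^ b          ∎

  ^-difference : ∀ g a b → (g ^ a) ⁻¹ ∙ g ^ b ≈ g ^ (b ℤ.- a)
  ^-difference g a b = begin
    (g ^ a) ⁻¹ ∙ g ^ b                       ≡⟨ ≡.cong (λ e → (g ^ a) ⁻¹ ∙ g ^ e) (≡.sym (a+[b-a] a b)) ⟩
    (g ^ a) ⁻¹ ∙ g ^ (a ℤ.+ (b ℤ.- a))       ≈⟨ ∙-congˡ (^-+ g a (b ℤ.- a)) ⟩
    (g ^ a) ⁻¹ ∙ (g ^ a ∙ g ^ (b ℤ.- a))     ≈⟨ cancelˡ⁻¹ _ _ ⟩
    g ^ (b ℤ.- a)                            ∎
    where
    a+[b-a] : ∀ a b → a ℤ.+ (b ℤ.- a) ≡ b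
    a+[b-a] = solve-∀

  ^-Fil : ∀ {j g} a → Fil j g → Fil j (g ^ a)
  ^-Fil {j} {g} (+ k) g∈ = ×ᴳ-Fil k
    where
    ×ᴳ-Fil : ∀ k → Fil j (k ×ᴳ g)
    ×ᴳ-Fil zero    = Fil-ε j
    ×ᴳ-Fil (suc k) = Fil-∙ j g∈ (×ᴳ-Fil k)
  ^-Fil -[1+ k ] g∈ = Fil-⁻¹ _ (^-Fil (+ suc k) g∈)

  -- If all (d+1)-fold differences of Q vanish and g ∈ G_{j+d}, then x ↦ g^{Q(x)}
  -- is polynomial of level j: its derivative g^{Δ_h Q} has the same form with d - 1.
  power-poly : ∀ {n} m {j} d {Q : Vec ℤ n → ℤ} {g} → Vanishes (suc d) Q → Fil (j + d) g →
               Poly j m (λ x → g ^ Q x)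
  power-poly zero {j} d {Q} v g∈ x = ^-Fil (Q x) (Fil-mono (m≤m+n j d) g∈)
  power-poly (suc m) {j} d {Q} {g} v g∈ = (λ x → ^-Fil (Q x) (Fil-mono (m≤m+n j d) g∈)) , λ h →
    poly-resp m (λ x → sym (^-difference g (Q x) (Q (x ⊞ h)))) (derivative d v g∈ h)
    where
    derivative : ∀ d → Vanishes (suc d) Q → Fil (j + d) g → ∀ h → Poly (suc j) m (λ x → g ^ Δ h Q x)
    derivative zero     v _  h = poly-resp m (λ x → reflexive (≡.cong (g ^_) (≡.sym (v h x)))) (poly-ε m)
    derivative (suc d′) v g∈ h = power-poly m d′ {Δ h Q} (v h) (≡.subst (λ i → Fil i g) (+-suc j d′) g∈)

  facePoly-on-cube : ∀ {n} (F : Face n) x → facePoly F (embed FG x) ≡ (if x ∈Face F then 1ℤ else 0ℤ)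
  facePoly-on-cube []               []          = ≡.refl
  facePoly-on-cube (nothing ∷ F)    (b ∷ x)     = facePoly-on-cube F x
  facePoly-on-cube (just true ∷ F)  (true ∷ x)  = ≡.trans (ℤ.*-identityˡ _) (facePoly-on-cube F x)
  facePoly-on-cube (just true ∷ F)  (false ∷ x) = ≡.refl
  facePoly-on-cube (just false ∷ F) (true ∷ x)  = ≡.refl
  facePoly-on-cube (just false ∷ F) (false ∷ x) = ≡.trans (ℤ.*-identityˡ _) (facePoly-on-cube F x)

  PolynomialExtension : ∀ {n} → (Cube n → Carrier) → Set (c ⊔ ℓ ⊔ p)
  PolynomialExtension {n} cc = Σ (Vec ℤ n → Carrier) λ g → Poly∞ 0 g × (∀ x → g (embed FG x) ≈ cc x)

  -- Every element of Cⁿ(G_•) extends: the generator g^F extends to x ↦ g^{facePoly F x},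
  -- and extensions are closed under the group operations.
  polynomial-extension : ∀ {n cc} → InC FG n cc → PolynomialExtension cc
  polynomial-extension (gen F {g} g∈) =
    (λ x → g ^ facePoly F x) ,
    (λ m → power-poly m (codim F) {facePoly F} (vanishes-facePoly F) g∈) ,
    λ x → trans (reflexive (≡.cong (g ^_) (facePoly-on-cube F x))) (power-indicator (x ∈Face F))
    where
    power-indicator : ∀ b → g ^ (if b then 1ℤ else 0ℤ) ≈ (if b then g else ε)
    power-indicator true  = identityʳ g
    power-indicator false = refl
  polynomial-extension one = (λ _ → ε) , poly-ε , λ x → refl
  polynomial-extension (mul a b) with polynomial-extension a | polynomial-extension b
  ... | ga , pa , ga≈a | gb , pb , gb≈b =
    (λ x → ga x ∙ gb x) , (λ m → poly-∙ m (pa m) (pb m)) , λ x → ∙-cong (ga≈a x) (gb≈b x)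
  polynomial-extension (inv a) with polynomial-extension a
  ... | ga , pa , ga≈a = (λ x → ga x ⁻¹) , (λ m → poly-⁻¹ m (pa m)) , λ x → ⁻¹-cong (ga≈a x)
  polynomial-extension (resp a≈b a) with polynomial-extension a
  ... | ga , pa , ga≈a = ga , pa , λ x → trans (ga≈a x) (a≈b x)

  -- Cⁿ of the shifted filtration (G_{k+i})ᵢ; for k = 0 this is Cⁿ(G_•).
  data InCₖ (k n : ℕ) : (Cube n → Carrier) → Set (c ⊔ ℓ ⊔ p) where
    genₖ  : ∀ (F : Face n) {g} → Fil (k + codim F) g → InCₖ k n (faceElt FG g F)
    oneₖ  : InCₖ k n (λ _ → ε)
    mulₖ  : ∀ {a b} → InCₖ k n a → InCₖ k n b → InCₖ k n (λ x → a x ∙ b x)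
    invₖ  : ∀ {a} → InCₖ k n a → InCₖ k n (λ x → a x ⁻¹)
    respₖ : ∀ {a b} → (∀ x → a x ≈ b x) → InCₖ k n a → InCₖ k n b

  InCₖ⇒InC : ∀ {n cc} → InCₖ 0 n cc → InC FG n cc
  InCₖ⇒InC (genₖ F g∈)   = gen F g∈
  InCₖ⇒InC oneₖ          = one
  InCₖ⇒InC (mulₖ a b)    = mul (InCₖ⇒InC a) (InCₖ⇒InC b)
  InCₖ⇒InC (invₖ a)      = inv (InCₖ⇒InC a)
  InCₖ⇒InC (respₖ e a)   = resp e (InCₖ⇒InC a)

  ignore-first : ∀ {k n cc} → InCₖ k n cc → InCₖ k (suc n) (λ x → cc (tail x))
  ignore-first (genₖ F g∈)  = respₖ (λ { (b ∷ y) → refl }) (genₖ (nothing ∷ F) g∈)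
  ignore-first oneₖ         = oneₖ
  ignore-first (mulₖ a b)   = mulₖ (ignore-first a) (ignore-first b)
  ignore-first (invₖ a)     = invₖ (ignore-first a)
  ignore-first (respₖ e a)  = respₖ (λ x → e (tail x)) (ignore-first a)

  onTopFace : ∀ {n} → (Cube n → Carrier) → Cube (suc n) → Carrier
  onTopFace cc (b ∷ y) = if b then cc y else ε

  -- Fixing a coordinate raises the codimension by one, which absorbs the shift:
  -- g^F becomes g^{(1, F)}.
  top-face : ∀ {k n cc} → InCₖ (suc k) n cc → InCₖ k (suc n) (onTopFace cc)
  top-face {k} (genₖ F {g} g∈) = respₖ (λ { (true ∷ y) → refl ; (false ∷ y) → refl })
    (genₖ (just true ∷ F) (≡.subst (λ i → Fil i g) (≡.sym (+-suc k (codim F))) g∈))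
  top-face oneₖ        = respₖ (λ { (true ∷ y) → refl ; (false ∷ y) → refl }) oneₖ
  top-face (mulₖ a b)  = respₖ (λ { (true ∷ y) → refl ; (false ∷ y) → identityˡ ε }) (mulₖ (top-face a) (top-face b))
  top-face (invₖ a)    = respₖ (λ { (true ∷ y) → refl ; (false ∷ y) → ε⁻¹≈ε }) (invₖ (top-face a))
  top-face (respₖ e a) = respₖ (λ { (true ∷ y) → e y ; (false ∷ y) → refl }) (top-face a)

  poly-slice : ∀ {n k} m {g : Vec ℤ (suc n) → Carrier} → Poly k m g → Poly k m (λ y → g (0ℤ ∷ y))
  poly-slice zero    pg y = pg (0ℤ ∷ y)
  poly-slice (suc m) pg = (λ y → proj₁ pg (0ℤ ∷ y)) , λ h → poly-slice m (proj₂ pg (0ℤ ∷ h))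

  e₁ : ∀ n → Vec ℤ (suc n)
  e₁ n = 1ℤ ∷ replicate n 0ℤ

  cube-split : ∀ {n} (g : Vec ℤ (suc n) → Carrier) (x : Cube (suc n)) →
    g (0ℤ ∷ embed FG (tail x)) ∙ onTopFace (λ y → ∂ FG (e₁ n) g (0ℤ ∷ embed FG y)) x ≈ g (embed FG x)
  cube-split g (false ∷ y) = identityʳ _
  cube-split g (true ∷ y)  = trans (cancelˡ _ _) (reflexive (≡.cong (λ v → g (1ℤ ∷ v)) (zipWith-identityʳ ℤ.+-identityʳ _)))

  restriction : ∀ n {k} (g : Vec ℤ n → Carrier) → Poly∞ k g → InCₖ k n (λ x → g (embed FG x))
  restriction zero {k} g pg =
    respₖ (λ { [] → refl }) (genₖ [] (≡.subst (λ i → Fil i (g [])) (≡.sym (+-identityʳ k)) (pg 0 [])))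
  restriction (suc n) {k} g pg = respₖ (cube-split g)
    (mulₖ (ignore-first (restriction n (λ y → g (0ℤ ∷ y)) λ m → poly-slice m (pg m)))
          (top-face (restriction n (λ y → ∂ FG (e₁ n) g (0ℤ ∷ y)) λ m → poly-slice m (proj₂ (pg (suc m)) (e₁ n)))))

corollary2p2p17 : ∀ {c ℓ p : Level} (FG : FilteredGroup c ℓ p) (n : ℕ)
    (cc : Cube n → FilteredGroup.Carrier FG) →
    InC FG n cc ⇔
      Σ (Zn FG n → FilteredGroup.Carrier FG) (λ g →
        IsPolynomial FG g × (∀ x → FilteredGroup._≈_ FG (g (embed FG x)) (cc x)))
corollary2p2p17 FG n cc = mk⇔
  (λ c → let g , g-poly , g≈cc = polynomial-extension c in g , Poly∞⇒polynomial g-poly , g≈cc)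
  (λ { (g , g-poly , g≈cc) → InCₖ⇒InC (respₖ g≈cc (restriction n g (polynomial⇒Poly∞ g-poly))) })
  where open FilteredPolynomials FG
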